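{- Let $\varphi$ be a non-erasing substitution on a finite alphabet $A$ that is prolongable on $a_1\in A$. Let $I_\varphi$ be the set of $\varphi$-growing letters and $B_\varphi$ the set of $\varphi$-bounded factors of $\varphi^\infty(a_1)$, including the empty word, and suppose $B_\varphi$ is finite. Let $C$ be the finite alphabet of symbols $[twt']$, where $t,t'\in I_\varphi$, $w\in B_\varphi$, and $twt'$ is a factor of $\varphi^\infty(a_1)$. Define $\varphi'\colon C^*\to C^*$ by $$\varphi'([twt'])=[t_1w_1t_2][t_2w_2t_3]\cdots[t_kw_kt_{k+1}],$$ where $\varphi(tw)=w_0t_1w_1t_2\cdots t_kw'_k$ with $t_i\in I_\varphi$ and $w_0,\dots,w_{k-1},w'_k\in B_\varphi$, $\varphi(t')$ begins with $w''_kt_{k+1}$ with $t_{k+1}\in I_\varphi$ and $w''_k\in B_\varphi$, and $w_k=w'_kw''_k$. Then every letter of $C$ is $\varphi'$-growing.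
   Context: A word $w$ is $\varphi$-bounded if the sequence $w,\varphi(w),\varphi^2(w),\dots$ is eventually periodic, and $\varphi$-growing otherwise, in which case $|\varphi^n(w)|\to\infty$. A substitution is non-erasing if no letter maps to the empty word. It is prolongable on $a_1$ if $\varphi(a_1)=a_1v$ with $\varphi^k(v)$ nonempty for all $k$, and $\varphi^\infty(a_1)$ denotes the resulting fixed point. -}

module Defs where

open import Data.Nat using (ℕ; zero; suc; _+_; _≤_; _<_)
open import Data.Fin using (Fin)
open import Data.List using (List; []; _∷_; _++_; concatMap; [_])
open import Data.List.Membership.Propositional using (_∈_)
open import Data.List.Relation.Unary.All using (All)
open import Data.Product using (Σ; ∃; ∃-syntax; _×_; _,_)
open import Relation.Binary.PropositionalEquality using (_≡_)
open import Relation.Nullary using (¬_)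

Subst : Set → Set
Subst X = X → List X

apply : {X : Set} → Subst X → List X → List X
apply φ w = concatMap φ w

iter : {X : Set} → Subst X → ℕ → List X → List X
iter φ zero    w = w
iter φ (suc k) w = apply φ (iter φ k w)

Bounded : {X : Set} → Subst X → List X → Set
Bounded φ w = ∃[ N ] ∃[ p ] (0 < p × (∀ m → N ≤ m → iter φ (m + p) w ≡ iter φ m w))

Growing : {X : Set} → Subst X → List X → Set
Growing φ w = ¬ Bounded φ w

GrowingLetter : {X : Set} → Subst X → X → Set
GrowingLetter φ a = Growing φ [ a ]

Factor : {X : Set} → List X → List X → Set
Factor u v = ∃[ x ] ∃[ y ] (v ≡ x ++ u ++ y)

NonErasing : {X : Set} → Subst X → Set
NonErasing φ = ∀ a → ¬ (φ a ≡ [])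

Prolongable : {X : Set} → Subst X → X → Set
Prolongable φ a₁ = ∃[ v ] (φ a₁ ≡ a₁ ∷ v × (∀ k → ¬ (iter φ k v ≡ [])))

-- u is a factor of the fixed point φ^∞(a₁) = lim φ^k(a₁); since (for prolongable φ)
-- each φ^k(a₁) is a prefix of φ^∞(a₁) and these prefixes exhaust it, the finite
-- factors of φ^∞(a₁) are exactly the factors of the words φ^k(a₁).
FactorFix : {X : Set} → Subst X → X → List X → Set
FactorFix φ a₁ u = ∃[ k ] Factor u (iter φ k [ a₁ ])

-- Membership in B_φ: φ-bounded factor of φ^∞(a₁) (the empty word included automatically).
InB : {X : Set} → Subst X → X → List X → Set
InB φ a₁ w = Bounded φ w × FactorFix φ a₁ w

BFinite : {X : Set} → Subst X → X → Set
BFinite φ a₁ = ∃[ L ] (∀ w → InB φ a₁ w → w ∈ L)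

Triple : Set → Set
Triple X = X × List X × X

InC : {X : Set} → Subst X → X → Triple X → Set
InC φ a₁ (t , w , t') =
  GrowingLetter φ t × InB φ a₁ w × GrowingLetter φ t' × FactorFix φ a₁ (t ∷ w ++ [ t' ])

-- Given the decomposition list ((t₁,w₁),…,(t_k,w'_k)), w''_k and t_{k+1},
-- build [t₁w₁t₂][t₂w₂t₃]…[t_k (w'_k w''_k) t_{k+1}].
mkTriples : {X : Set} → List (X × List X) → List X → X → List (Triple X)
mkTriples []                        w'' t' = []
mkTriples ((t , u) ∷ [])            w'' t' = (t , u ++ w'' , t') ∷ []
mkTriples ((t , u) ∷ ((s , v) ∷ ps)) w'' t' = (t , u , s) ∷ mkTriples ((s , v) ∷ ps) w'' t'

flatten : {X : Set} → List (X × List X) → List X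
flatten []             = []
flatten ((t , u) ∷ ps) = t ∷ u ++ flatten ps

DefEq : {X : Set} → Subst X → X → Subst (Triple X) → Triple X → Set
DefEq φ a₁ φ' (t , w , t') =
  ∃[ w₀ ] ∃[ ps ] ∃[ w'' ] ∃[ tk1 ] ∃[ rest ]
    ( apply φ (t ∷ w) ≡ w₀ ++ flatten ps
    × InB φ a₁ w₀
    × All (λ p → GrowingLetter φ (Data.Product.proj₁ p) × InB φ a₁ (Data.Product.proj₂ p)) ps
    × φ t' ≡ w'' ++ tk1 ∷ rest
    × InB φ a₁ w''
    × GrowingLetter φ tk1
    × φ' (t , w , t') ≡ mkTriples ps w'' tk1 )

IsPhiPrime : {X : Set} → Subst X → X → Subst (Triple X) → Set
IsPhiPrime φ a₁ φ' = ∀ c → InC φ a₁ c → DefEq φ a₁ φ' c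

-- Suppose some symbol c = [t w t'] of C were φ'-bounded. Then its orbit under φ' is finite, so the
-- words φ'^m(c) have bounded length. The symbols of φ'^m(c) form a chain
-- [t₁w₁t₂][t₂w₂t₃]…[t_k w_k t_{k+1}], and φ^m(t w) followed by a φ-bounded word equals
-- P · t₁w₁t₂w₂…t_k w_k for some P ∈ B_φ. As B_φ is finite, |φ^m(t)| is therefore bounded
-- independently of m; over a finite alphabet the orbit of t is then finite, so t is φ-bounded,
-- contradicting t ∈ I_φ.
module Submission where

open import Defs
open import Data.Nat using (ℕ; zero; suc; _+_; _*_; _≤_; _<_; z≤n; s≤s; _∸_)
open import Data.Nat.Properties
open import Data.Nat.ListAction using (sum)
open import Data.Fin using (Fin; toℕ)
open import Data.Fin.Properties using (pigeonhole)
open import Data.List using (List; []; _∷_; _++_; [_]; length; map; allFin; lookup; applyUpTo; cartesianProductWith)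
open import Data.List.Properties using (++-assoc; length-++; ++-identityʳ; length-++-≤ˡ; length-++-≤ʳ; ∷-injectiveˡ; ∷-injectiveʳ)
open import Data.List.Membership.Propositional using (_∈_)
open import Data.List.Membership.Propositional.Properties using (∈-allFin; ∈-applyUpTo⁺; ∈-cartesianProductWith⁺)
open import Data.List.Relation.Unary.All using (All; []; _∷_)
open import Data.List.Relation.Unary.All.Properties using (++⁻ʳ)
open import Data.List.Relation.Unary.Any using (here; there; index)
open import Data.List.Relation.Unary.Any.Properties using (lookup-index)
open import Data.Product using (∃-syntax; _×_; _,_; proj₁; proj₂)
open import Data.Sum using (inj₁; inj₂)
open import Data.Empty using (⊥-elim)
open import Relation.Binary.PropositionalEquality hiding ([_])
open import Relation.Nullary using (¬_)

apply-++ : {X : Set} (φ : Subst X) (u v : List X) → apply φ (u ++ v) ≡ apply φ u ++ apply φ v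
apply-++ φ []      v = refl
apply-++ φ (a ∷ u) v = trans (cong (φ a ++_) (apply-++ φ u v)) (sym (++-assoc (φ a) _ _))

++-injective-length : {X : Set} (u v u' v' : List X) → length u ≡ length u' → u ++ v ≡ u' ++ v' → u ≡ u' × v ≡ v'
++-injective-length []      v []       v' _   eq = refl , eq
++-injective-length (a ∷ u) v (a' ∷ u') v' len eq
  with ++-injective-length u v u' v' (suc-injective len) (∷-injectiveʳ eq)
... | u≡u' , v≡v' = cong₂ _∷_ (∷-injectiveˡ eq) u≡u' , v≡v'

∈⇒length≤sum : {X : Set} {w : List X} {L : List (List X)} → w ∈ L → length w ≤ sum (map length L)
∈⇒length≤sum {L = v ∷ L} (here refl) = m≤m+n _ _
∈⇒length≤sum {L = v ∷ L} (there w∈L) = ≤-trans (∈⇒length≤sum w∈L) (m≤n+m _ _)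

FiniteOrbit : {X : Set} → Subst X → List X → Set
FiniteOrbit φ w = ∃[ L ] (∀ m → iter φ m w ∈ L)

module Iteration {X : Set} (φ : Subst X) where

  iter-[] : ∀ m → iter φ m [] ≡ []
  iter-[] zero    = refl
  iter-[] (suc m) = cong (apply φ) (iter-[] m)

  iter-++ : ∀ m (u v : List X) → iter φ m (u ++ v) ≡ iter φ m u ++ iter φ m v
  iter-++ zero    u v = refl
  iter-++ (suc m) u v = trans (cong (apply φ) (iter-++ m u v)) (apply-++ φ (iter φ m u) (iter φ m v))

  iter-apply : ∀ m (u : List X) → iter φ m (apply φ u) ≡ apply φ (iter φ m u)
  iter-apply zero    u = refl
  iter-apply (suc m) u = cong (apply φ) (iter-apply m u)

  iter-+ : ∀ i j (w : List X) → iter φ (i + j) w ≡ iter φ i (iter φ j w)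
  iter-+ zero    j w = refl
  iter-+ (suc i) j w = cong (apply φ) (iter-+ i j w)

  iter-period-* : ∀ {u} N p → (∀ m → N ≤ m → iter φ (m + p) u ≡ iter φ m u)
                → ∀ q m → N ≤ m → iter φ (m + p * q) u ≡ iter φ m u
  iter-period-* {u} N p period zero m N≤m =
    cong (λ k → iter φ k u) (trans (cong (m +_) (*-zeroʳ p)) (+-identityʳ m))
  iter-period-* {u} N p period (suc q) m N≤m = begin
    iter φ (m + p * suc q) u   ≡⟨ cong (λ k → iter φ k u) m+p*[1+q] ⟩
    iter φ (m + p * q + p) u   ≡⟨ period (m + p * q) (≤-trans N≤m (m≤m+n m _)) ⟩
    iter φ (m + p * q) u       ≡⟨ iter-period-* N p period q m N≤m ⟩
    iter φ m u                 ∎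
    where
    open ≡-Reasoning
    m+p*[1+q] : m + p * suc q ≡ m + p * q + p
    m+p*[1+q] = trans (cong (m +_) (trans (*-suc p q) (+-comm p (p * q)))) (sym (+-assoc m (p * q) p))

  bounded-[] : Bounded φ []
  bounded-[] = 0 , 1 , s≤s z≤n , λ m _ → trans (iter-[] (m + 1)) (sym (iter-[] m))

  -- Both orbits are periodic with period p₁ * p₂ from max N₁ N₂ (bounded here by N₁ + N₂) on.
  bounded-++ : ∀ {u v} → Bounded φ u → Bounded φ v → Bounded φ (u ++ v)
  bounded-++ {u} {v} (N₁ , suc a , _ , period₁) (N₂ , suc b , _ , period₂) =
    N₁ + N₂ , suc a * suc b , s≤s z≤n , λ m N≤m →
      trans (iter-++ (m + suc a * suc b) u v)
        (trans (cong₂ _++_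
                  (iter-period-* N₁ (suc a) period₁ (suc b) m (≤-trans (m≤m+n N₁ N₂) N≤m))
                  (trans (cong (λ k → iter φ (m + k) v) (*-comm (suc a) (suc b)))
                         (iter-period-* N₂ (suc b) period₂ (suc a) m (≤-trans (m≤n+m N₂ N₁) N≤m))))
          (sym (iter-++ m u v)))

  bounded-apply : ∀ {u} → Bounded φ u → Bounded φ (apply φ u)
  bounded-apply {u} (N , p , p>0 , period) = N , p , p>0 , λ m N≤m →
    trans (iter-apply (m + p) u) (trans (cong (apply φ) (period m N≤m)) (sym (iter-apply m u)))

  bounded-apply⁻ : ∀ {u} → Bounded φ (apply φ u) → Bounded φ u
  bounded-apply⁻ {u} (N , p , p>0 , period) = suc N , p , p>0 , λ where
    (suc m) (s≤s N≤m) → trans (sym (iter-apply (m + p) u)) (trans (period m N≤m) (iter-apply m u))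

  repeat⇒bounded : ∀ {u} i j → i < j → iter φ i u ≡ iter φ j u → Bounded φ u
  repeat⇒bounded {u} i j i<j φⁱu≡φʲu = i , j ∸ i , m<n⇒0<n∸m i<j , period
    where
    open ≡-Reasoning
    period : ∀ m → i ≤ m → iter φ (m + (j ∸ i)) u ≡ iter φ m u
    period m i≤m = begin
      iter φ (m + (j ∸ i)) u          ≡⟨ cong (λ k → iter φ k u) m+[j∸i]≡[m∸i]+j ⟩
      iter φ ((m ∸ i) + j) u          ≡⟨ iter-+ (m ∸ i) j u ⟩
      iter φ (m ∸ i) (iter φ j u)     ≡⟨ cong (iter φ (m ∸ i)) (sym φⁱu≡φʲu) ⟩
      iter φ (m ∸ i) (iter φ i u)     ≡⟨ sym (iter-+ (m ∸ i) i u) ⟩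
      iter φ ((m ∸ i) + i) u          ≡⟨ cong (λ k → iter φ k u) (m∸n+n≡m i≤m) ⟩
      iter φ m u                      ∎
      where
      m+[j∸i]≡[m∸i]+j : m + (j ∸ i) ≡ (m ∸ i) + j
      m+[j∸i]≡[m∸i]+j = begin
        m + (j ∸ i)              ≡⟨ cong (_+ (j ∸ i)) (sym (m∸n+n≡m i≤m)) ⟩
        (m ∸ i) + i + (j ∸ i)    ≡⟨ +-assoc (m ∸ i) i (j ∸ i) ⟩
        (m ∸ i) + (i + (j ∸ i))  ≡⟨ cong ((m ∸ i) +_) (m+[n∸m]≡n (<⇒≤ i<j)) ⟩
        (m ∸ i) + j              ∎

  bounded⇒finiteOrbit : ∀ {u} → Bounded φ u → FiniteOrbit φ u
  bounded⇒finiteOrbit {u} (N , p , p>0 , period) =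
    applyUpTo (λ k → iter φ k u) (N + p) , λ m → let (k , k<N+p , eq) = earlier m in
      subst (_∈ applyUpTo (λ k → iter φ k u) (N + p)) (sym eq) (∈-applyUpTo⁺ (λ k → iter φ k u) k<N+p)
    where
    earlier : ∀ m → ∃[ k ] (k < N + p × iter φ m u ≡ iter φ k u)
    earlier zero = 0 , ≤-trans p>0 (m≤n+m p N) , refl
    earlier (suc m) with earlier m
    ... | k , k<N+p , eq with m≤n⇒m<n∨m≡n k<N+p
    ...   | inj₁ 1+k<N+p = suc k , 1+k<N+p , cong (apply φ) eq
    ...   | inj₂ 1+k≡N+p = N , m<m+n N p>0 ,
            trans (cong (apply φ) eq)
                  (trans (cong (λ j → iter φ j u) 1+k≡N+p) (period N ≤-refl))

  finiteOrbit⇒bounded : ∀ {u} → FiniteOrbit φ u → Bounded φ u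
  finiteOrbit⇒bounded {u} (L , ∈L) with pigeonhole (n<1+n (length L)) (λ i → index (∈L (toℕ i)))
  ... | i , j , i<j , same-index = repeat⇒bounded (toℕ i) (toℕ j) i<j
    (trans (lookup-index (∈L (toℕ i))) (trans (cong (lookup L) same-index) (sym (lookup-index (∈L (toℕ j))))))

module NonErasingSubst {X : Set} (φ : Subst X) (ne : NonErasing φ) where
  open Iteration φ

  length-apply-≥ : ∀ (w : List X) → length w ≤ length (apply φ w)
  length-apply-≥ []      = z≤n
  length-apply-≥ (a ∷ w) = ≤-trans (s≤s (length-apply-≥ w)) (nonempty-++ (φ a) (ne a))
    where
    nonempty-++ : ∀ (x : List X) → ¬ x ≡ [] → suc (length (apply φ w)) ≤ length (x ++ apply φ w)
    nonempty-++ []      x≢[] = ⊥-elim (x≢[] refl)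
    nonempty-++ (b ∷ x) _    = s≤s (length-++-≤ʳ (apply φ w) {x})

  length-iter-mono : ∀ (w : List X) m d → length (iter φ m w) ≤ length (iter φ (m + d) w)
  length-iter-mono w m zero    = ≤-reflexive (cong (λ k → length (iter φ k w)) (sym (+-identityʳ m)))
  length-iter-mono w m (suc d) =
    subst (λ k → length (iter φ m w) ≤ length (iter φ k w)) (sym (+-suc m d))
      (≤-trans (length-iter-mono w m d) (length-apply-≥ (iter φ (m + d) w)))

  -- Non-erasure makes |φ^m(u)| non-decreasing, so periodicity of φ^m(u) φ^m(v) forces
  -- |φ^(m+p)(u)| = |φ^m(u)|, and the two factors can be separated.
  bounded-++⁻ : ∀ u v → Bounded φ (u ++ v) → Bounded φ u × Bounded φ v
  bounded-++⁻ u v (N , p , p>0 , period) =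
    (N , p , p>0 , λ m N≤m → proj₁ (periods m N≤m)) , (N , p , p>0 , λ m N≤m → proj₂ (periods m N≤m))
    where
    periods : ∀ m → N ≤ m → iter φ (m + p) u ≡ iter φ m u × iter φ (m + p) v ≡ iter φ m v
    periods m N≤m = ++-injective-length _ _ _ _ (≤-antisym shrinks (length-iter-mono u m p)) eq
      where
      eq : iter φ (m + p) u ++ iter φ (m + p) v ≡ iter φ m u ++ iter φ m v
      eq = trans (sym (iter-++ (m + p) u v)) (trans (period m N≤m) (iter-++ m u v))
      total : length (iter φ (m + p) u) + length (iter φ (m + p) v) ≡ length (iter φ m u) + length (iter φ m v)
      total = trans (sym (length-++ (iter φ (m + p) u))) (trans (cong length eq) (length-++ (iter φ m u)))
      shrinks : length (iter φ (m + p) u) ≤ length (iter φ m u)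
      shrinks = +-cancelʳ-≤ (length (iter φ (m + p) v)) _ _
        (≤-trans (≤-reflexive total) (+-monoʳ-≤ (length (iter φ m u)) (length-iter-mono v m p)))

  BoundedLetters : List X → Set
  BoundedLetters = All (λ a → Bounded φ [ a ])

  bounded⇒boundedLetters : ∀ w → Bounded φ w → BoundedLetters w
  bounded⇒boundedLetters []      _ = []
  bounded⇒boundedLetters (a ∷ w) b =
    proj₁ (bounded-++⁻ [ a ] w b) ∷ bounded⇒boundedLetters w (proj₂ (bounded-++⁻ [ a ] w b))

  first-growing-unique : ∀ (x x' : List X) {g g' y y'} → BoundedLetters x → BoundedLetters x'
    → GrowingLetter φ g → GrowingLetter φ g' → x ++ g ∷ y ≡ x' ++ g' ∷ y' → x ≡ x' × g ≡ g'
  first-growing-unique []      []        _        _          _ _  eq = refl , ∷-injectiveˡ eq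
  first-growing-unique []      (a ∷ x')  _        (ba ∷ _)   g _  eq =
    ⊥-elim (g (subst (λ z → Bounded φ [ z ]) (sym (∷-injectiveˡ eq)) ba))
  first-growing-unique (a ∷ x) []        (ba ∷ _) _          _ g' eq =
    ⊥-elim (g' (subst (λ z → Bounded φ [ z ]) (∷-injectiveˡ eq) ba))
  first-growing-unique (a ∷ x) (a' ∷ x') (_ ∷ bx) (_ ∷ bx')  g g' eq
    with first-growing-unique x x' bx bx' g g' (∷-injectiveʳ eq)
  ... | x≡x' , g≡g' = cong₂ _∷_ (∷-injectiveˡ eq) x≡x' , g≡g'

  prefix-before-growing : ∀ (P Y : List X) {E g Z} → BoundedLetters E → GrowingLetter φ g
    → Y ++ E ≡ P ++ g ∷ Z → ∃[ Z' ] (Y ≡ P ++ Z')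
  prefix-before-growing []      Y       _  _ _  = Y , refl
  prefix-before-growing (p ∷ P) []      bE g eq with subst BoundedLetters eq bE
  ... | _ ∷ bPgZ with ++⁻ʳ P bPgZ
  ...   | bg ∷ _ = ⊥-elim (g bg)
  prefix-before-growing (p ∷ P) (x ∷ Y) bE g eq with prefix-before-growing P Y bE g (∷-injectiveʳ eq)
  ... | Z' , Y≡PZ' = Z' , cong₂ _∷_ (∷-injectiveˡ eq) Y≡PZ'

module FixedPointFactors {X : Set} (φ : Subst X) (a₁ : X) where

  factorFix-infix : ∀ (x u y : List X) → FactorFix φ a₁ (x ++ u ++ y) → FactorFix φ a₁ u
  factorFix-infix x u y (k , x₀ , y₀ , eq) = k , x₀ ++ x , y ++ y₀ ,
    trans eq (trans (cong (x₀ ++_) (trans (++-assoc x _ y₀) (cong (x ++_) (++-assoc u y y₀))))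
      (sym (++-assoc x₀ x _)))

  factorFix-prefix : ∀ (u y : List X) → FactorFix φ a₁ (u ++ y) → FactorFix φ a₁ u
  factorFix-prefix u y = factorFix-infix [] u y

  factorFix-suffix : ∀ (x u : List X) → FactorFix φ a₁ (x ++ u) → FactorFix φ a₁ u
  factorFix-suffix x u f = factorFix-infix x u [] (subst (λ z → FactorFix φ a₁ (x ++ z)) (sym (++-identityʳ u)) f)

  factorFix-apply : ∀ {u} → FactorFix φ a₁ u → FactorFix φ a₁ (apply φ u)
  factorFix-apply {u} (k , x , y , eq) = suc k , apply φ x , apply φ y ,
    trans (cong (apply φ) eq) (trans (apply-++ φ x _) (cong (apply φ x ++_) (apply-++ φ u y)))

  factorFix-iter : ∀ {u} → FactorFix φ a₁ u → ∀ j → FactorFix φ a₁ (iter φ j u)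
  factorFix-iter f zero    = f
  factorFix-iter f (suc j) = factorFix-apply (factorFix-iter f j)

  []∈B : InB φ a₁ []
  []∈B = Iteration.bounded-[] φ , 0 , [] , [ a₁ ] , refl

spell : {X : Set} → List (Triple X) → List X
spell []                 = []
spell ((s , v , _) ∷ L) = s ∷ v ++ spell L

spell-++ : {X : Set} (K L : List (Triple X)) → spell (K ++ L) ≡ spell K ++ spell L
spell-++ []                 L = refl
spell-++ ((s , v , _) ∷ K) L = cong (s ∷_) (trans (cong (v ++_) (spell-++ K L)) (sym (++-assoc v _ _)))

spell-mkTriples : {X : Set} (t : X) (u : List X) (ps : List (X × List X)) (w'' : List X) (t' : X)
  → spell (mkTriples ((t , u) ∷ ps) w'' t') ≡ flatten ((t , u) ∷ ps) ++ w''
spell-mkTriples t u []             w'' t' =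
  cong (t ∷_) (trans (++-identityʳ _) (cong (_++ w'') (sym (++-identityʳ u))))
spell-mkTriples t u ((s , v) ∷ ps) w'' t' =
  cong (t ∷_) (trans (cong (u ++_) (spell-mkTriples s v ps w'' t')) (sym (++-assoc u _ w'')))

module DerivedSubstitution {X : Set} (φ : Subst X) (a₁ : X) (ne : NonErasing φ)
                           (φ' : Subst (Triple X)) (isφ' : IsPhiPrime φ a₁ φ') where
  open Iteration φ
  open NonErasingSubst φ ne
  open FixedPointFactors φ a₁

  data Chain : X → List (Triple X) → X → Set where
    [_]ᶜ : ∀ {s v s'} → InC φ a₁ (s , v , s') → Chain s ((s , v , s') ∷ []) s'
    _∷ᶜ_ : ∀ {s v s' L e} → InC φ a₁ (s , v , s') → Chain s' L e → Chain s ((s , v , s') ∷ L) e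

  chain-++ : ∀ {a K b L e} → Chain a K b → Chain b L e → Chain a (K ++ L) e
  chain-++ [ c ]ᶜ    cL = c ∷ᶜ cL
  chain-++ (c ∷ᶜ cK) cL = c ∷ᶜ chain-++ cK cL

  chain-head : ∀ {a L e} → Chain a L e → GrowingLetter φ a × ∃[ Y ] (spell L ≡ a ∷ Y)
  chain-head ([_]ᶜ {v = v} c)          = proj₁ c , v ++ [] , refl
  chain-head (_∷ᶜ_ {v = v} {L = L} c _) = proj₁ c , v ++ spell L , refl

  chain-last : ∀ {a L e} → Chain a L e → GrowingLetter φ e
  chain-last [ c ]ᶜ   = proj₁ (proj₂ (proj₂ c))
  chain-last (_ ∷ᶜ cL) = chain-last cL

  length-spell-chain : ∀ {M a L e} → (∀ w → InB φ a₁ w → length w ≤ M) → Chain a L e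
    → length (spell L) ≤ length L * suc M
  length-spell-chain B≤M ([_]ᶜ {v = v} c) =
    s≤s (≤-trans (≤-reflexive (length-++ v)) (+-mono-≤ (B≤M v (proj₁ (proj₂ c))) z≤n))
  length-spell-chain B≤M (_∷ᶜ_ {v = v} c cL) =
    s≤s (≤-trans (≤-reflexive (length-++ v)) (+-mono-≤ (B≤M v (proj₁ (proj₂ c))) (length-spell-chain B≤M cL)))

  chain-mkTriples : ∀ (t : X) (u : List X) ps w'' (t' : X)
    → All (λ p → GrowingLetter φ (proj₁ p) × InB φ a₁ (proj₂ p)) ((t , u) ∷ ps)
    → InB φ a₁ w'' → GrowingLetter φ t'
    → FactorFix φ a₁ (flatten ((t , u) ∷ ps) ++ w'' ++ [ t' ])
    → Chain t (mkTriples ((t , u) ∷ ps) w'' t') t'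
  chain-mkTriples t u [] w'' t' ((gt , u∈B) ∷ []) w''∈B gt' fac =
    [ gt , (bounded-++ (proj₁ u∈B) (proj₁ w''∈B) , factorFix-infix [ t ] (u ++ w'') [ t' ] fac') , gt' , fac' ]ᶜ
    where
    fac' : FactorFix φ a₁ (t ∷ (u ++ w'') ++ [ t' ])
    fac' = subst (FactorFix φ a₁)
      (cong (t ∷_) (trans (cong (_++ (w'' ++ [ t' ])) (++-identityʳ u)) (sym (++-assoc u w'' [ t' ])))) fac
  chain-mkTriples t u ((s , v) ∷ ps) w'' t' ((gt , u∈B) ∷ rest@((gs , _) ∷ _)) w''∈B gt' fac =
    (gt , u∈B , gs , facHead) ∷ᶜ chain-mkTriples s v ps w'' t' rest w''∈B gt' facTail
    where
    R = v ++ flatten ps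
    W = w'' ++ [ t' ]
    facHead : FactorFix φ a₁ (t ∷ u ++ [ s ])
    facHead = factorFix-prefix (t ∷ u ++ [ s ]) (R ++ W)
      (subst (FactorFix φ a₁) (cong (t ∷_) (trans (++-assoc u (s ∷ R) W) (sym (++-assoc u [ s ] (R ++ W))))) fac)
    facTail : FactorFix φ a₁ ((s ∷ R) ++ W)
    facTail = factorFix-suffix (t ∷ u) ((s ∷ R) ++ W) (subst (FactorFix φ a₁) (cong (t ∷_) (++-assoc u (s ∷ R) W)) fac)

  -- φ(U) = w₀ a' y, where w₀ ∈ B_φ precedes the first growing letter a', and φ(U) w'' spells the
  -- chain V from a' to e', where w'' ∈ B_φ precedes the first growing letter e' of φ(e).
  record Unfolding (U : List X) (V : List (Triple X)) (e : X) : Set where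
    field
      w₀ w'' : List X
      a' e' : X
      y rest : List X
      apply≡ : apply φ U ≡ w₀ ++ a' ∷ y
      apply-++≡ : apply φ U ++ w'' ≡ w₀ ++ spell V
      image-last≡ : φ e ≡ w'' ++ e' ∷ rest
      w₀∈B : InB φ a₁ w₀
      w''∈B : InB φ a₁ w''
      chain : Chain a' V e'
  open Unfolding

  unfold-symbol : ∀ {t w t'} → InC φ a₁ (t , w , t') → Unfolding (t ∷ w) (φ' (t , w , t')) t'
  unfold-symbol {t} {w} {t'} c@(gt , _ , _ , fac) with isφ' (t , w , t') c
  ... | w₀ , [] , _ , _ , _ , φtw≡w₀ , w₀∈B , _ , _ , _ , _ , _ =
    ⊥-elim (gt (bounded-apply⁻ (proj₁ (bounded-++⁻ (apply φ [ t ]) (apply φ w)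
       (subst (Bounded φ) (sym (trans (sym (apply-++ φ [ t ] w)) (trans φtw≡w₀ (++-identityʳ w₀)))) (proj₁ w₀∈B))))))
  ... | w₀ , (t₁ , u₁) ∷ ps , w'' , tₖ₊₁ , rest , φtw≡ , w₀∈B , ps∈ , φt'≡ , w''∈B , gtₖ₊₁ , φ'c≡ =
    record { w₀ = w₀ ; w'' = w'' ; a' = t₁ ; e' = tₖ₊₁ ; y = u₁ ++ flatten ps ; rest = rest
           ; apply≡ = φtw≡ ; apply-++≡ = spells ; image-last≡ = φt'≡ ; w₀∈B = w₀∈B ; w''∈B = w''∈B
           ; chain = subst (λ V → Chain t₁ V tₖ₊₁) (sym φ'c≡) (chain-mkTriples t₁ u₁ ps w'' tₖ₊₁ ps∈ w''∈B gtₖ₊₁ facF) }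
    where
    F = flatten ((t₁ , u₁) ∷ ps)
    spells : apply φ (t ∷ w) ++ w'' ≡ w₀ ++ spell (φ' (t , w , t'))
    spells = trans (cong (_++ w'') φtw≡) (trans (++-assoc w₀ F w'')
               (cong (w₀ ++_) (sym (trans (cong spell φ'c≡) (spell-mkTriples t₁ u₁ ps w'' tₖ₊₁)))))
    φ[twt']≡ : apply φ ((t ∷ w) ++ [ t' ]) ≡ w₀ ++ (F ++ w'' ++ [ tₖ₊₁ ]) ++ (rest ++ [])
    φ[twt']≡ = trans (apply-++ φ (t ∷ w) [ t' ])
           (trans (cong₂ _++_ φtw≡ (cong (_++ []) φt'≡))
           (trans (++-assoc w₀ F _)
           (cong (w₀ ++_) (trans (cong (F ++_) (++-assoc w'' (tₖ₊₁ ∷ rest) []))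
             (sym (trans (++-assoc F (w'' ++ [ tₖ₊₁ ]) (rest ++ []))
                  (cong (F ++_) (++-assoc w'' [ tₖ₊₁ ] (rest ++ [])))))))))
    facF : FactorFix φ a₁ (F ++ w'' ++ [ tₖ₊₁ ])
    facF = factorFix-infix w₀ (F ++ w'' ++ [ tₖ₊₁ ]) (rest ++ []) (subst (FactorFix φ a₁) φ[twt']≡ (factorFix-apply fac))

  unfold-chain : ∀ {a L e} → Chain a L e → Unfolding (spell L) (apply φ' L) e
  unfold-chain ([_]ᶜ {s} {v} {s'} c) =
    subst₂ (λ U V → Unfolding U V s') (sym (++-identityʳ (s ∷ v))) (sym (++-identityʳ _)) (unfold-symbol c)
  unfold-chain (_∷ᶜ_ {s} {v} {s'} {L} {e} c cL) = record
    { w₀ = w₀ Uc ; w'' = w'' UL ; a' = a' Uc ; e' = e' UL ; y = y Uc ++ apply φ (spell L) ; rest = rest UL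
    ; apply≡ = trans (apply-++ φ (s ∷ v) (spell L))
                     (trans (cong (_++ apply φ (spell L)) (apply≡ Uc)) (++-assoc (w₀ Uc) _ _))
    ; apply-++≡ = spells ; image-last≡ = image-last≡ UL ; w₀∈B = w₀∈B Uc ; w''∈B = w''∈B UL
    ; chain = chain-++ (chain Uc) (subst (λ a → Chain a (apply φ' L) (e' UL)) (sym (proj₂ glue)) (chain UL)) }
    where
    open ≡-Reasoning
    Uc = unfold-symbol c
    UL = unfold-chain cL
    Y = proj₁ (proj₂ (chain-head cL))
    -- φ(spell L) has two decompositions at its first growing letter: via φ(s') and via UL.
    φ[spell-L]≡ : apply φ (spell L) ≡ w'' Uc ++ e' Uc ∷ (rest Uc ++ apply φ Y)
    φ[spell-L]≡ = trans (cong (apply φ) (proj₂ (proj₂ (chain-head cL))))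
      (trans (cong (_++ apply φ Y) (image-last≡ Uc)) (++-assoc (w'' Uc) (e' Uc ∷ rest Uc) (apply φ Y)))
    glue : w'' Uc ≡ w₀ UL × e' Uc ≡ a' UL
    glue = first-growing-unique (w'' Uc) (w₀ UL)
      (bounded⇒boundedLetters _ (proj₁ (w''∈B Uc))) (bounded⇒boundedLetters _ (proj₁ (w₀∈B UL)))
      (chain-last (chain Uc)) (proj₁ (chain-head (chain UL))) (trans (sym φ[spell-L]≡) (apply≡ UL))
    VL = apply φ' L
    spells : apply φ ((s ∷ v) ++ spell L) ++ w'' UL ≡ w₀ Uc ++ spell (φ' (s , v , s') ++ VL)
    spells = begin
      apply φ ((s ∷ v) ++ spell L) ++ w'' UL           ≡⟨ cong (_++ w'' UL) (apply-++ φ (s ∷ v) (spell L)) ⟩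
      (apply φ (s ∷ v) ++ apply φ (spell L)) ++ w'' UL ≡⟨ ++-assoc (apply φ (s ∷ v)) _ _ ⟩
      apply φ (s ∷ v) ++ (apply φ (spell L) ++ w'' UL) ≡⟨ cong (apply φ (s ∷ v) ++_) (apply-++≡ UL) ⟩
      apply φ (s ∷ v) ++ (w₀ UL ++ spell VL)           ≡⟨ cong (λ z → apply φ (s ∷ v) ++ (z ++ spell VL)) (sym (proj₁ glue)) ⟩
      apply φ (s ∷ v) ++ (w'' Uc ++ spell VL)          ≡⟨ sym (++-assoc (apply φ (s ∷ v)) _ _) ⟩
      (apply φ (s ∷ v) ++ w'' Uc) ++ spell VL          ≡⟨ cong (_++ spell VL) (apply-++≡ Uc) ⟩
      (w₀ Uc ++ spell (φ' (s , v , s'))) ++ spell VL   ≡⟨ ++-assoc (w₀ Uc) _ _ ⟩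
      w₀ Uc ++ (spell (φ' (s , v , s')) ++ spell VL)   ≡⟨ cong (w₀ Uc ++_) (sym (spell-++ (φ' (s , v , s')) VL)) ⟩
      w₀ Uc ++ spell (φ' (s , v , s') ++ VL)           ∎

  record IterateDecomposition (t : X) (w : List X) (t' : X) (m : ℕ) : Set where
    field
      P E : List X
      a e : X
      decomposes : iter φ m (t ∷ w) ++ E ≡ P ++ spell (iter φ' m [ (t , w , t') ])
      E-bounded : Bounded φ E
      P∈B : InB φ a₁ P
      orbit-chain : Chain a (iter φ' m [ (t , w , t') ]) e

  iterate-decomposition : ∀ {t w t'} → InC φ a₁ (t , w , t') → ∀ m → IterateDecomposition t w t' m
  iterate-decomposition c zero = record
    { P = [] ; E = [] ; a = _ ; e = _ ; decomposes = refl ; E-bounded = bounded-[] ; P∈B = []∈B ; orbit-chain = [ c ]ᶜ }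
  iterate-decomposition {t} {w} {t'} c@(_ , _ , _ , fac) (suc m) = record
    { P = P' ; E = E' ; a = a' U ; e = e' U ; decomposes = decomposes'
    ; E-bounded = E'-bounded ; P∈B = bounded-++ (bounded-apply (proj₁ P∈B)) (proj₁ (w₀∈B U)) , P'-factor
    ; orbit-chain = chain U }
    where
    open IterateDecomposition (iterate-decomposition c m)
    open ≡-Reasoning
    U = unfold-chain orbit-chain
    L = iter φ' m [ (t , w , t') ]
    φᵐtw = iter φ m (t ∷ w)
    P' = apply φ P ++ w₀ U
    E' = apply φ E ++ w'' U
    decomposes' : apply φ φᵐtw ++ E' ≡ P' ++ spell (apply φ' L)
    decomposes' = begin
      apply φ φᵐtw ++ (apply φ E ++ w'' U)        ≡⟨ sym (++-assoc (apply φ φᵐtw) (apply φ E) (w'' U)) ⟩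
      (apply φ φᵐtw ++ apply φ E) ++ w'' U        ≡⟨ cong (_++ w'' U) (sym (apply-++ φ φᵐtw E)) ⟩
      apply φ (φᵐtw ++ E) ++ w'' U                ≡⟨ cong (λ z → apply φ z ++ w'' U) decomposes ⟩
      apply φ (P ++ spell L) ++ w'' U             ≡⟨ cong (_++ w'' U) (apply-++ φ P (spell L)) ⟩
      (apply φ P ++ apply φ (spell L)) ++ w'' U   ≡⟨ ++-assoc (apply φ P) _ _ ⟩
      apply φ P ++ (apply φ (spell L) ++ w'' U)   ≡⟨ cong (apply φ P ++_) (apply-++≡ U) ⟩
      apply φ P ++ (w₀ U ++ spell (apply φ' L))   ≡⟨ sym (++-assoc (apply φ P) (w₀ U) _) ⟩
      P' ++ spell (apply φ' L)                    ∎
    E'-bounded : Bounded φ E'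
    E'-bounded = bounded-++ (bounded-apply E-bounded) (proj₁ (w''∈B U))
    -- P' ends before the first growing letter of the right-hand side, which lies inside φ^(m+1)(t w).
    P'-prefix : ∃[ Z ] (apply φ φᵐtw ≡ P' ++ Z)
    P'-prefix = prefix-before-growing P' (apply φ φᵐtw) (bounded⇒boundedLetters _ E'-bounded)
      (proj₁ (chain-head (chain U)))
      (trans decomposes' (cong (P' ++_) (proj₂ (proj₂ (chain-head (chain U))))))
    φᵐ⁺¹tw-factor : FactorFix φ a₁ (apply φ φᵐtw)
    φᵐ⁺¹tw-factor = factorFix-prefix (iter φ (suc m) (t ∷ w)) (iter φ (suc m) [ t' ])
      (subst (FactorFix φ a₁) (iter-++ (suc m) (t ∷ w) [ t' ]) (factorFix-iter fac (suc m)))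
    P'-factor : FactorFix φ a₁ P'
    P'-factor = factorFix-prefix P' (proj₁ P'-prefix) (subst (FactorFix φ a₁) (proj₂ P'-prefix) φᵐ⁺¹tw-factor)

  length-iter-≤ : ∀ {t w t'} M K → InC φ a₁ (t , w , t') → (∀ v → InB φ a₁ v → length v ≤ M)
    → (∀ m → length (iter φ' m [ (t , w , t') ]) ≤ K) → ∀ m → length (iter φ m [ t ]) ≤ M + K * suc M
  length-iter-≤ {t} {w} {t'} M K c B≤M φ'ᵐc≤K m = begin
    length (iter φ m [ t ])                         ≤⟨ length-++-≤ˡ (iter φ m [ t ]) ⟩
    length (iter φ m [ t ] ++ iter φ m w)           ≡⟨ cong length (sym (iter-++ m [ t ] w)) ⟩
    length (iter φ m (t ∷ w))                       ≤⟨ length-++-≤ˡ (iter φ m (t ∷ w)) ⟩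
    length (iter φ m (t ∷ w) ++ E)                  ≡⟨ cong length decomposes ⟩
    length (P ++ spell L)                           ≡⟨ length-++ P ⟩
    length P + length (spell L)                     ≤⟨ +-mono-≤ (B≤M P P∈B) (length-spell-chain B≤M orbit-chain) ⟩
    M + length L * suc M                            ≤⟨ +-monoʳ-≤ M (*-monoˡ-≤ (suc M) (φ'ᵐc≤K m)) ⟩
    M + K * suc M                                   ∎
    where
    open ≤-Reasoning
    open IterateDecomposition (iterate-decomposition c m)
    L = iter φ' m [ (t , w , t') ]

words≤ : (n : ℕ) → ℕ → List (List (Fin n))
words≤ n zero    = [ [] ]
words≤ n (suc R) = [] ∷ cartesianProductWith _∷_ (allFin n) (words≤ n R)

∈-words≤ : {n : ℕ} (R : ℕ) {w : List (Fin n)} → length w ≤ R → w ∈ words≤ n R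
∈-words≤ zero    {[]}    _         = here refl
∈-words≤ (suc R) {[]}    _         = here refl
∈-words≤ (suc R) {a ∷ w} (s≤s w≤R) = there (∈-cartesianProductWith⁺ _∷_ (∈-allFin a) (∈-words≤ R w≤R))

mainTheorem3 : (n : ℕ) (φ : Subst (Fin n)) (a₁ : Fin n)
    → NonErasing φ → Prolongable φ a₁ → BFinite φ a₁
    → (φ' : Subst (Triple (Fin n))) → IsPhiPrime φ a₁ φ'
    → ∀ c → InC φ a₁ c → GrowingLetter φ' c
mainTheorem3 n φ a₁ ne _ (B , ∈B) φ' isφ' (t , w , t') c∈C c-bounded =
  proj₁ c∈C (Iteration.finiteOrbit⇒bounded φ
    (words≤ n (M + K * suc M) , λ m → ∈-words≤ (M + K * suc M) (length-iter-≤ M K c∈C B≤M φ'ᵐc≤K m)))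
  where
  open DerivedSubstitution φ a₁ ne φ' isφ'
  M : ℕ
  M = sum (map length B)
  B≤M : ∀ v → InB φ a₁ v → length v ≤ M
  B≤M v v∈B = ∈⇒length≤sum (∈B v v∈B)
  orbit : FiniteOrbit φ' [ (t , w , t') ]
  orbit = Iteration.bounded⇒finiteOrbit φ' c-bounded
  K : ℕ
  K = sum (map length (proj₁ orbit))
  φ'ᵐc≤K : ∀ m → length (iter φ' m [ (t , w , t') ]) ≤ K
  φ'ᵐc≤K m = ∈⇒length≤sum (proj₂ orbit m)
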